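{- Let $d$ be a positive integer and let $f\colon\mathbb{N}^d\to\mathbb{N}$ be any $d$-tupling function with cubic shells. Let $n$ be a non-negative integer. If the non-negative integers $x_1,x_2,\ldots,x_d$ each have a binary representation with $n$ or fewer bits, then the binary representation of $f(x_1,x_2,\ldots,x_d)$ has $nd$ or fewer bits.
   Context: $\mathbb{N}$ denotes the set of non-negative integers. A $d$-tupling function for $\mathbb{N}$ is a bijection $\mathbb{N}^d\to\mathbb{N}$; it has cubic shells if for all $\mathbf{x},\mathbf{y}\in\mathbb{N}^d$, $\max(\mathbf{x})<\max(\mathbf{y})$ implies $f(\mathbf{x})<f(\mathbf{y})$. The number of bits in the binary representation of a non-negative integer $x$ is $\lceil\log_2(x+1)\rceil$. -}

module Defs where

open import Data.Nat using (ℕ; suc; _<_; _⊔_)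
open import Data.Nat.Logarithm using (⌈log₂_⌉)
open import Data.Vec using (Vec; foldr′)
open import Function.Bundles using (_⤖_; Bijection)

-- maximum entry of a tuple (0 for the empty tuple; d ≥ 1 in the theorem)
maxᵥ : ∀ {d} → Vec ℕ d → ℕ
maxᵥ = foldr′ _⊔_ 0

TuplingFunction : ℕ → Set
TuplingFunction d = Vec ℕ d ⤖ ℕ

HasCubicShells : ∀ {d} → TuplingFunction d → Set
HasCubicShells {d} f = ∀ (x y : Vec ℕ d) →
  maxᵥ x < maxᵥ y → Bijection.to f x < Bijection.to f y

bits : ℕ → ℕ
bits x = ⌈log₂ suc x ⌉

module Submission where

-- Write  m = 2 ^ n.  A number has at most n bits exactly when it
-- is below 2 ^ n, so the hypothesis says that every entry of x is below m, and
-- the goal says that f x < m ^ d = 2 ^ (n * d).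
--
-- The bound  f x < m ^ d  holds for every tuple x with max x < m, for every m.
-- Every code i ≤ f x is the image of some tuple y, and cubic shells force
-- max y < m (otherwise max x < max y would give f x < f y = i).  So the
-- f x + 1 codes 0, …, f x are images of distinct tuples in the box {0,…,m-1}^d,
-- which has only m ^ d elements; hence f x + 1 ≤ m ^ d.

open import Defs
open import Data.Nat using (ℕ; _≤_; _*_; NonZero)
open import Data.Vec using (Vec)
open import Data.Vec.Relation.Unary.All using (All)
open import Function.Bundles using (Bijection)

open import Data.Nat using (zero; suc; _+_; _<_; _^_; z≤n; s≤s; ⌈_/2⌉; ⌊_/2⌋; _<?_; s≤s⁻¹)
open import Data.Nat.Properties
open import Data.Nat.Logarithm using (⌈log₂_⌉; ⌈log₂⌉-mono-≤; ⌈log₂2^n⌉≡n)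
open import Data.Nat.Logarithm.Core using (⌈log2⌉)
open import Data.Nat.Induction using (<-wellFounded)
open import Induction.WellFounded using (Acc; acc)
open import Data.Vec using ([]; _∷_; map)
open import Data.Vec.Relation.Unary.All using ([]; _∷_) renaming (map to All-map)
open import Data.Fin using (Fin; toℕ; fromℕ<; combine) renaming (zero to fzero)
open import Data.Fin.Properties using (toℕ-fromℕ<; combine-injective; injective⇒≤; toℕ-injective; toℕ<n)
open import Data.Product using (_,_)
open import Function.Bundles using (Surjection)
open import Relation.Nullary using (yes; no; contradiction)
open import Relation.Binary.PropositionalEquality

n≤⌈n/2⌉+⌈n/2⌉ : ∀ n → n ≤ ⌈ n /2⌉ + ⌈ n /2⌉
n≤⌈n/2⌉+⌈n/2⌉ n = begin
  n                     ≡⟨ sym (⌊n/2⌋+⌈n/2⌉≡n n) ⟩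
  ⌊ n /2⌋ + ⌈ n /2⌉     ≤⟨ +-monoˡ-≤ ⌈ n /2⌉ (⌊n/2⌋≤⌈n/2⌉ n) ⟩
  ⌈ n /2⌉ + ⌈ n /2⌉     ∎
  where open ≤-Reasoning

-- The ceiling logarithm really is an upper bound: a ≤ 2 ^ ⌈log₂ a⌉.
-- By the recursion defining ⌈log2⌉:  2 + n ≤ 2 (1 + ⌈n/2⌉) ≤ 2 · 2 ^ ⌈log₂ (1 + ⌈n/2⌉)⌉.
≤2^⌈log2⌉ : ∀ a (ac : Acc _<_ a) → a ≤ 2 ^ ⌈log2⌉ a ac
≤2^⌈log2⌉ zero          _        = z≤n
≤2^⌈log2⌉ (suc zero)    _        = s≤s z≤n
≤2^⌈log2⌉ (suc (suc n)) (acc rs) = begin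
  suc (suc n)                 ≤⟨ s≤s (s≤s (n≤⌈n/2⌉+⌈n/2⌉ n)) ⟩
  suc (suc (c + c))           ≡⟨ cong suc (sym (+-suc c c)) ⟩
  suc c + suc c               ≤⟨ +-mono-≤ half (≤-trans half (≤-reflexive (sym (+-identityʳ _)))) ⟩
  2 ^ ⌈log2⌉ (suc (suc n)) (acc rs) ∎
  where
  open ≤-Reasoning
  c : ℕ
  c = ⌈ n /2⌉
  half : suc c ≤ 2 ^ ⌈log2⌉ (suc c) _
  half = ≤2^⌈log2⌉ (suc c) _

bits≤⇒<2^ : ∀ {x k} → bits x ≤ k → x < 2 ^ k
bits≤⇒<2^ {x} bx≤k = ≤-trans (≤2^⌈log2⌉ (suc x) (<-wellFounded (suc x))) (^-monoʳ-≤ 2 bx≤k)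

<2^⇒bits≤ : ∀ {x k} → x < 2 ^ k → bits x ≤ k
<2^⇒bits≤ {x} {k} x<2^k = begin
  ⌈log₂ suc x ⌉   ≤⟨ ⌈log₂⌉-mono-≤ x<2^k ⟩
  ⌈log₂ 2 ^ k ⌉   ≡⟨ ⌈log₂2^n⌉≡n k ⟩
  k               ∎
  where open ≤-Reasoning

maxᵥ< : ∀ {m k} → 0 < m → (x : Vec ℕ k) → All (_< m) x → maxᵥ x < m
maxᵥ< 0<m []      []         = 0<m
maxᵥ< 0<m (a ∷ x) (a<m ∷ x<m) = ⊔-lub a<m (maxᵥ< 0<m x x<m)

toFins : ∀ {m k} (x : Vec ℕ k) → maxᵥ x < m → Vec (Fin m) k
toFins []      _     = []
toFins (a ∷ x) x<m = fromℕ< (≤-<-trans (m≤m⊔n a _) x<m) ∷ toFins x (≤-<-trans (m≤n⊔m a _) x<m)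

toFins-toℕ : ∀ {m k} (x : Vec ℕ k) (x<m : maxᵥ x < m) → map toℕ (toFins x x<m) ≡ x
toFins-toℕ []      _ = refl
toFins-toℕ (a ∷ x) _ = cong₂ _∷_ (toℕ-fromℕ< _) (toFins-toℕ x _)

encode : ∀ {m k} → Vec (Fin m) k → Fin (m ^ k)
encode []      = fzero
encode (a ∷ v) = combine a (encode v)

encode-injective : ∀ {m k} (u v : Vec (Fin m) k) → encode u ≡ encode v → u ≡ v
encode-injective []      []      _  = refl
encode-injective (a ∷ u) (b ∷ v) eq with combine-injective a (encode u) b (encode v) eq
... | refl , eu≡ev = cong (a ∷_) (encode-injective u v eu≡ev)

boxCode : ∀ {m k} (x : Vec ℕ k) → maxᵥ x < m → Fin (m ^ k)
boxCode x x<m = encode (toFins x x<m)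

boxCode-injective : ∀ {m k} (x y : Vec ℕ k) (x<m : maxᵥ x < m) (y<m : maxᵥ y < m) →
  boxCode x x<m ≡ boxCode y y<m → x ≡ y
boxCode-injective x y x<m y<m eq = begin
  x                          ≡⟨ sym (toFins-toℕ x x<m) ⟩
  map toℕ (toFins x x<m)     ≡⟨ cong (map toℕ) (encode-injective _ _ eq) ⟩
  map toℕ (toFins y y<m)     ≡⟨ toFins-toℕ y y<m ⟩
  y                          ∎
  where open ≡-Reasoning

module BoxBound {d : ℕ} (f : TuplingFunction d) (shells : HasCubicShells f) where
  open Surjection (Bijection.surjection f) using (to; to⁻; to∘to⁻)

  below⇒inBox : ∀ {m} (x y : Vec ℕ d) → maxᵥ x < m → to y ≤ to x → maxᵥ y < m
  below⇒inBox {m} x y x<m fy≤fx with maxᵥ y <? m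
  ... | yes y<m = y<m
  ... | no  y≮m = contradiction fy≤fx (<⇒≱ (shells x y (<-≤-trans x<m (≮⇒≥ y≮m))))

  -- The codes 0, …, f x come from distinct tuples in the box, of which there are m ^ d.
  to<m^d : ∀ {m} (x : Vec ℕ d) → maxᵥ x < m → to x < m ^ d
  to<m^d {m} x x<m = injective⇒≤ {f = codeOfPreimage} codeOfPreimage-injective
    where
    preimage-inBox : (i : Fin (suc (to x))) → maxᵥ (to⁻ (toℕ i)) < m
    preimage-inBox i = below⇒inBox x (to⁻ (toℕ i)) x<m
      (subst (_≤ to x) (sym (to∘to⁻ (toℕ i))) (s≤s⁻¹ (toℕ<n i)))

    codeOfPreimage : Fin (suc (to x)) → Fin (m ^ d)
    codeOfPreimage i = boxCode (to⁻ (toℕ i)) (preimage-inBox i)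

    codeOfPreimage-injective : ∀ {i j} → codeOfPreimage i ≡ codeOfPreimage j → i ≡ j
    codeOfPreimage-injective {i} {j} eq = toℕ-injective (begin
      toℕ i               ≡⟨ sym (to∘to⁻ (toℕ i)) ⟩
      to (to⁻ (toℕ i))    ≡⟨ cong to (boxCode-injective _ _ _ _ eq) ⟩
      to (to⁻ (toℕ j))    ≡⟨ to∘to⁻ (toℕ j) ⟩
      toℕ j               ∎)
      where open ≡-Reasoning

theorem11 : (d : ℕ) → .{{_ : NonZero d}} → (f : TuplingFunction d) → HasCubicShells f →
    (n : ℕ) → (x : Vec ℕ d) → All (λ xi → bits xi ≤ n) x →
    bits (Bijection.to f x) ≤ n * d
theorem11 d f shells n x bitsx≤n = <2^⇒bits≤ (begin-strict
  Bijection.to f x   <⟨ BoxBound.to<m^d f shells x x<2^n ⟩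
  (2 ^ n) ^ d        ≡⟨ ^-*-assoc 2 n d ⟩
  2 ^ (n * d)        ∎)
  where
  open ≤-Reasoning
  x<2^n : maxᵥ x < 2 ^ n
  x<2^n = maxᵥ< (m^n>0 2 n) x (All-map bits≤⇒<2^ bitsx≤n)
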